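{- Let $m\ge0$ be even. The number of distinct values taken by the pivots of the self twin parsimonious games with $m+4$ players whose free type representation has an odd number of components is $\frac m2+1$.
   Context: Parsimonious (P) games: constant-sum homogeneous weighted majority games on $n$ players, without dummies and without dictator, having exactly $n$ minimal winning coalitions (homogeneous: weights $\mathbf w$, quota $q$, $S$ winning iff $\sum_{i\in S}w_i\ge q$, with equality for every minimal winning $S$). Each has a unique minimal homogeneous representation with integer weights $1=w_1\le\dots\le w_n$. Binary representation: $\mathbf b\in\{0,1\}^n$, $b_1=1$, $b_i=1$ iff $w_i>w_{i-1}$. Known: $b_1=1,b_2=0,b_{n-1}=0,b_n=1$ always, and $(b_3,\dots,b_{n-2})$ determines the game, every vector in $\{0,1\}^{n-4}$ arising. The number of types $h$ is the number of distinct weights; the type representation is $(x_1,\dots,x_h)$, $x_t$ the number of players with the $t$-th smallest distinct weight; the free type representation is $(x_1,\dots,x_{h-1})$. A P game is self twin if $b_i=b_{n+1-i}$ for $i=3,\dots,n-2$. When $h-1$ is odd, the middle component $x_{h/2}$ is called the pivot. -}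

module Defs where

open import Data.Bool using (Bool; true; false)
open import Data.Bool.Properties using () renaming (_≟_ to _≟B_)
open import Data.Nat using (ℕ; zero; suc; _%_; _/_)
open import Data.Nat.Properties using () renaming (_≟_ to _≟ℕ_)
open import Data.List using (List; []; _∷_; _++_; length; map; filter; concatMap; deduplicate)
open import Data.Vec using (Vec; []; _∷_; toList; reverse)
open import Data.Vec.Properties using (≡-dec)
open import Data.Product using (_×_)
open import Relation.Binary.PropositionalEquality using (_≡_)
open import Relation.Nullary using (Dec)
open import Relation.Nullary.Decidable using (_×-dec_)

-- A parsimonious game on m + 4 players is identified with its free binary
-- vector (b_3,...,b_{m+2}) ∈ {0,1}^m (every such vector arises, uniquely).

binRep : {m : ℕ} → Vec Bool m → List Bool
binRep v = true ∷ false ∷ (toList v ++ (false ∷ true ∷ []))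

-- blocks: k = size of current block; a 1 starts a new block
blocks : ℕ → List Bool → List ℕ
blocks k []           = k ∷ []
blocks k (true ∷ bs)  = k ∷ blocks 1 bs
blocks k (false ∷ bs) = blocks (suc k) bs

-- type representation (x_1,...,x_h) from a binary representation (b_1 = 1)
typeRep : List Bool → List ℕ
typeRep []       = []
typeRep (_ ∷ bs) = blocks 1 bs

dropLast : List ℕ → List ℕ
dropLast []           = []
dropLast (x ∷ [])     = []
dropLast (x ∷ y ∷ xs) = x ∷ dropLast (y ∷ xs)

freeTypeRep : {m : ℕ} → Vec Bool m → List ℕ
freeTypeRep v = dropLast (typeRep (binRep v))

-- 0-based indexing with default 0
nth : List ℕ → ℕ → ℕ
nth []       _       = 0
nth (x ∷ xs) zero    = x
nth (x ∷ xs) (suc i) = nth xs i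

-- pivot: for free type rep of odd length h-1, the component x_{h/2}
-- (1-based), i.e. 0-based index (h-1)/2 = length / 2
pivot : {m : ℕ} → Vec Bool m → ℕ
pivot v = nth (freeTypeRep v) (length (freeTypeRep v) / 2)

-- self twin: b_i = b_{n+1-i} for i = 3..n-2, i.e. the free vector is a palindrome
SelfTwin : {m : ℕ} → Vec Bool m → Set
SelfTwin v = v ≡ reverse v

OddFree : {m : ℕ} → Vec Bool m → Set
OddFree v = length (freeTypeRep v) % 2 ≡ 1

qualifies? : {m : ℕ} (v : Vec Bool m) → Dec (SelfTwin v × OddFree v)
qualifies? v = ≡-dec _≟B_ v (reverse v) ×-dec (length (freeTypeRep v) % 2 ≟ℕ 1)

allVecs : (m : ℕ) → List (Vec Bool m)
allVecs zero    = [] ∷ []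
allVecs (suc m) = concatMap (λ v → (false ∷ v) ∷ (true ∷ v) ∷ []) (allVecs m)

pivotValues : ℕ → List ℕ
pivotValues m = deduplicate _≟ℕ_ (map pivot (filter qualifies? (allVecs m)))

{-# OPTIONS --safe #-}
module Submission where

-- A self twin game on j + j + 4 players has free vector u ++ reverse u with length u = j.
-- If u ends in a one followed by exactly t zeros, the two innermost ones open a block of
-- size 1 + 2t, and since u and reverse u contain equally many ones this block is the exact
-- middle of the free type representation, whose length is therefore odd; the pivot is
-- 1 + 2t with t < j. If u has no one, the free type representation is the single block
-- 3 + 2j. Every u of length j occurs, so the pivots are the j + 1 distinct numbers
-- 3 + 2j and 1 + 2t, t < j.

open import Defs
open import Data.Nat using (ℕ; _+_; _/_)
open import Data.Nat.Divisibility using (_∣_)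
open import Data.List using (length)
open import Relation.Binary.PropositionalEquality using (_≡_)

open import Function.Base using (_∘_)
open import Function.Bundles using (_⇔_; mk⇔; Equivalence)
open import Data.Bool using (Bool; true; false)
open import Data.Nat using (zero; suc; _*_; _∸_; _⊓_; _<_; _%_; s≤s)
open import Data.Nat.Properties
open import Data.Nat.DivMod using (+-distrib-/-∣ʳ; m*n/n≡m; [m+kn]%n≡m%n)
open import Data.Nat.Divisibility using (divides)
open import Data.Product using (∃; ∃₂; _×_; _,_; proj₁; proj₂)
open import Data.List
  using (List; []; _∷_; _++_; [_]; _∷ʳ_; replicate; reverse; take; drop; map; filter; applyUpTo; deduplicate)
open import Data.List.Properties
  using (++-assoc; length-++; length-replicate; length-reverse; length-applyUpTo; length-take; length-drop;
         take++drop≡id; reverse-++; reverse-involutive; unfold-reverse; ∷-injectiveʳ)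
open import Data.Vec as Vec using (Vec; toList)
open import Data.Vec.Properties
  using (toList-injective; toList-reverse; length-toList; toList-cast; toList∘fromList)
open import Data.Vec.Relation.Binary.Equality.Cast using (cast-is-id)
open import Data.List.Relation.Unary.Any as Any using (here; there)
open import Data.List.Relation.Unary.All as All using ()
open import Data.List.Relation.Unary.AllPairs using (_∷_)
open import Data.List.Relation.Unary.Unique.Propositional using (Unique)
open import Data.List.Relation.Unary.Unique.Propositional.Properties using (applyUpTo⁺₁)
import Data.List.Relation.Unary.Unique.DecPropositional.Properties as UniqueDec
open import Data.List.Membership.Propositional using (_∈_)
open import Data.List.Membership.Propositional.Properties
  using ( ∈-map⁺; ∈-map⁻; ∈-filter⁺; ∈-filter⁻; ∈-concatMap⁺; ∈-applyUpTo⁺; ∈-applyUpTo⁻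
        ; deduplicate-∈⇔)
open import Data.List.Membership.Propositional.Properties.WithK using (unique∧set⇒bag)
open import Data.List.Relation.Binary.BagAndSetEquality using (∼bag⇒↭)
open import Data.List.Relation.Binary.Permutation.Propositional.Properties using (↭-length)
open import Relation.Binary.Definitions using (DecidableEquality)
open import Relation.Binary.PropositionalEquality
  using (_≢_; refl; sym; trans; cong; cong₂; subst; module ≡-Reasoning)

open ≡-Reasoning

n+n≡n*2 : ∀ n → n + n ≡ n * 2
n+n≡n*2 n = sym (trans (*-suc n 1) (cong (n +_) (*-identityʳ n)))

[1+n*2]/2≡n : ∀ n → (1 + n * 2) / 2 ≡ n
[1+n*2]/2≡n n = trans (+-distrib-/-∣ʳ 1 {d = 2} (divides n refl)) (m*n/n≡m n 2)

++-cancelˡ-equal-length : ∀ {A : Set} (xs ys : List A) {zs ws : List A} →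
                          length xs ≡ length ys → xs ++ zs ≡ ys ++ ws → zs ≡ ws
++-cancelˡ-equal-length []       []       _   eq = eq
++-cancelˡ-equal-length (x ∷ xs) (y ∷ ys) len eq =
  ++-cancelˡ-equal-length xs ys (suc-injective len) (∷-injectiveʳ eq)

replicate-∷ʳ : ∀ {A : Set} n (x : A) → replicate n x ∷ʳ x ≡ x ∷ replicate n x
replicate-∷ʳ zero    x = refl
replicate-∷ʳ (suc n) x = cong (x ∷_) (replicate-∷ʳ n x)

reverse-replicate : ∀ {A : Set} n (x : A) → reverse (replicate n x) ≡ replicate n x
reverse-replicate zero    x = refl
reverse-replicate (suc n) x = begin
  reverse (x ∷ replicate n x)   ≡⟨ unfold-reverse x (replicate n x) ⟩
  reverse (replicate n x) ∷ʳ x  ≡⟨ cong (_∷ʳ x) (reverse-replicate n x) ⟩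
  replicate n x ∷ʳ x            ≡⟨ replicate-∷ʳ n x ⟩
  x ∷ replicate n x             ∎

length-deduplicate-≡ : ∀ {A : Set} (_≟_ : DecidableEquality A) {xs ys : List A} →
                       Unique ys → (∀ {x} → x ∈ xs ⇔ x ∈ ys) →
                       length (deduplicate _≟_ xs) ≡ length ys
length-deduplicate-≡ _≟_ {xs} {ys} ys-unique xs⇔ys =
  ↭-length (∼bag⇒↭ (unique∧set⇒bag (UniqueDec.deduplicate-! _≟_ xs) ys-unique dedup⇔ys))
  where
  dedup⇔ys : ∀ {x} → x ∈ deduplicate _≟_ xs ⇔ x ∈ ys
  dedup⇔ys = mk⇔ (Equivalence.to xs⇔ys ∘ Equivalence.from (deduplicate-∈⇔ _≟_))
                 (Equivalence.to (deduplicate-∈⇔ _≟_) ∘ Equivalence.from xs⇔ys)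

countTrue : List Bool → ℕ
countTrue []           = 0
countTrue (true ∷ bs)  = suc (countTrue bs)
countTrue (false ∷ bs) = countTrue bs

countTrue-++ : ∀ bs cs → countTrue (bs ++ cs) ≡ countTrue bs + countTrue cs
countTrue-++ []           cs = refl
countTrue-++ (true ∷ bs)  cs = cong suc (countTrue-++ bs cs)
countTrue-++ (false ∷ bs) cs = countTrue-++ bs cs

countTrue-reverse : ∀ bs → countTrue (reverse bs) ≡ countTrue bs
countTrue-reverse []       = refl
countTrue-reverse (b ∷ bs) = begin
  countTrue (reverse (b ∷ bs))              ≡⟨ cong countTrue (unfold-reverse b bs) ⟩
  countTrue (reverse bs ∷ʳ b)               ≡⟨ countTrue-++ (reverse bs) [ b ] ⟩
  countTrue (reverse bs) + countTrue [ b ]  ≡⟨ cong (_+ countTrue [ b ]) (countTrue-reverse bs) ⟩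
  countTrue bs + countTrue [ b ]            ≡⟨ +-comm (countTrue bs) _ ⟩
  countTrue [ b ] + countTrue bs            ≡⟨ countTrue-++ [ b ] bs ⟨
  countTrue (b ∷ bs)                        ∎

length-blocks : ∀ k bs → length (blocks k bs) ≡ suc (countTrue bs)
length-blocks k []           = refl
length-blocks k (true ∷ bs)  = cong suc (length-blocks 1 bs)
length-blocks k (false ∷ bs) = length-blocks (suc k) bs

blocks-++-true : ∀ k bs cs → blocks k (bs ++ true ∷ cs) ≡ blocks k bs ++ blocks 1 cs
blocks-++-true k []           cs = refl
blocks-++-true k (true ∷ bs)  cs = cong (k ∷_) (blocks-++-true 1 bs cs)
blocks-++-true k (false ∷ bs) cs = blocks-++-true (suc k) bs cs

blocks-replicate-false : ∀ k n bs → blocks k (replicate n false ++ bs) ≡ blocks (k + n) bs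
blocks-replicate-false k zero    bs = cong (λ i → blocks i bs) (sym (+-identityʳ k))
blocks-replicate-false k (suc n) bs =
  trans (blocks-replicate-false (suc k) n bs) (cong (λ i → blocks i bs) (sym (+-suc k n)))

dropLast-∷ʳ : ∀ xs (y : ℕ) → dropLast (xs ∷ʳ y) ≡ xs
dropLast-∷ʳ []           y = refl
dropLast-∷ʳ (x ∷ [])     y = refl
dropLast-∷ʳ (x ∷ x′ ∷ xs) y = cong (x ∷_) (dropLast-∷ʳ (x′ ∷ xs) y)

nth-length-++ : ∀ xs y ys → nth (xs ++ y ∷ ys) (length xs) ≡ y
nth-length-++ []       y ys = refl
nth-length-++ (x ∷ xs) y ys = nth-length-++ xs y ys

middle : List ℕ → ℕ
middle xs = nth xs (length xs / 2)

Centred : ℕ → List ℕ → Set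
Centred y zs = ∃₂ λ xs ys → length xs ≡ length ys × zs ≡ xs ++ y ∷ ys

length-balanced : ∀ xs (y : ℕ) ys → length xs ≡ length ys →
                  length (xs ++ y ∷ ys) ≡ 1 + length xs * 2
length-balanced xs y ys balanced = begin
  length (xs ++ y ∷ ys)        ≡⟨ length-++ xs ⟩
  length xs + suc (length ys)  ≡⟨ cong (λ n → length xs + suc n) balanced ⟨
  length xs + suc (length xs)  ≡⟨ +-suc (length xs) _ ⟩
  1 + (length xs + length xs)  ≡⟨ cong suc (n+n≡n*2 (length xs)) ⟩
  1 + length xs * 2            ∎

middle-centred : ∀ {y zs} → Centred y zs → middle zs ≡ y
middle-centred {y} (xs , ys , balanced , refl) = begin
  nth zs (length zs / 2)            ≡⟨ cong (λ n → nth zs (n / 2)) (length-balanced xs y ys balanced) ⟩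
  nth zs ((1 + length xs * 2) / 2)  ≡⟨ cong (nth zs) ([1+n*2]/2≡n (length xs)) ⟩
  nth zs (length xs)                ≡⟨ nth-length-++ xs y ys ⟩
  y                                 ∎
  where zs = xs ++ y ∷ ys

length-centred-odd : ∀ {y zs} → Centred y zs → length zs % 2 ≡ 1
length-centred-odd {y} (xs , ys , balanced , refl) =
  trans (cong (_% 2) (length-balanced xs y ys balanced)) ([m+kn]%n≡m%n 1 (length xs) 2)

-- freeTypeRep v unfolds to freeTypeRepᴸ (toList v), and pivot v to its middle; the
-- leading 1, 0 of the binary representation make the first block start at size 2.
freeTypeRepᴸ : List Bool → List ℕ
freeTypeRepᴸ bs = dropLast (blocks 2 (bs ++ false ∷ true ∷ []))

freeTypeRepᴸ≡blocks : ∀ bs → freeTypeRepᴸ bs ≡ blocks 2 (bs ∷ʳ false)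
freeTypeRepᴸ≡blocks bs = begin
  dropLast (blocks 2 (bs ++ false ∷ true ∷ []))
    ≡⟨ cong (dropLast ∘ blocks 2) (++-assoc bs [ false ] [ true ]) ⟨
  dropLast (blocks 2 ((bs ∷ʳ false) ++ true ∷ []))
    ≡⟨ cong dropLast (blocks-++-true 2 (bs ∷ʳ false) []) ⟩
  dropLast (blocks 2 (bs ∷ʳ false) ∷ʳ 1)            ≡⟨ dropLast-∷ʳ _ 1 ⟩
  blocks 2 (bs ∷ʳ false)                            ∎

mirror : List Bool → List Bool
mirror u = u ++ reverse u

length-mirror : ∀ u → length (mirror u) ≡ length u + length u
length-mirror u = trans (length-++ u) (cong (length u +_) (length-reverse u))

mirror-palindrome : ∀ u → mirror u ≡ reverse (mirror u)
mirror-palindrome u = sym (begin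
  reverse (u ++ reverse u)            ≡⟨ reverse-++ u (reverse u) ⟩
  reverse (reverse u) ++ reverse u    ≡⟨ cong (_++ reverse u) (reverse-involutive u) ⟩
  u ++ reverse u                      ∎)

palindrome-mirror : ∀ j bs → length bs ≡ j + j → bs ≡ reverse bs →
                    ∃ λ u → length u ≡ j × bs ≡ mirror u
palindrome-mirror j bs len palindrome =
  u , length-u , trans (sym (take++drop≡id j bs)) (cong (u ++_) w≡reverse-u)
  where
  u = take j bs
  w = drop j bs
  length-u : length u ≡ j
  length-u = trans (length-take j bs) (trans (cong (j ⊓_) len) (m≤n⇒m⊓n≡m (m≤m+n j j)))
  length-reverse-w : length (reverse w) ≡ j
  length-reverse-w =
    trans (length-reverse w) (trans (length-drop j bs) (trans (cong (_∸ j) len) (m+n∸m≡n j j)))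
  w≡reverse-u : w ≡ reverse u
  w≡reverse-u = ++-cancelˡ-equal-length u (reverse w) (trans length-u (sym length-reverse-w)) (begin
    u ++ w                ≡⟨ take++drop≡id j bs ⟩
    bs                    ≡⟨ palindrome ⟩
    reverse bs            ≡⟨ cong reverse (take++drop≡id j bs) ⟨
    reverse (u ++ w)      ≡⟨ reverse-++ u w ⟩
    reverse w ++ reverse u ∎)

mirror-++-true : ∀ xs t → let zeros = replicate t false in
                 mirror (xs ++ true ∷ zeros) ≡ xs ++ true ∷ zeros ++ zeros ++ true ∷ reverse xs
mirror-++-true xs t = begin
  (xs ++ true ∷ zeros) ++ reverse (xs ++ true ∷ zeros)
    ≡⟨ cong ((xs ++ true ∷ zeros) ++_) (reverse-++ xs (true ∷ zeros)) ⟩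
  (xs ++ true ∷ zeros) ++ reverse (true ∷ zeros) ++ reverse xs
    ≡⟨ cong (λ r → (xs ++ true ∷ zeros) ++ r ++ reverse xs) (unfold-reverse true zeros) ⟩
  (xs ++ true ∷ zeros) ++ (reverse zeros ∷ʳ true) ++ reverse xs
    ≡⟨ cong (λ r → (xs ++ true ∷ zeros) ++ (r ∷ʳ true) ++ reverse xs) (reverse-replicate t false) ⟩
  (xs ++ true ∷ zeros) ++ (zeros ∷ʳ true) ++ reverse xs
    ≡⟨ ++-assoc xs (true ∷ zeros) _ ⟩
  xs ++ true ∷ zeros ++ (zeros ∷ʳ true) ++ reverse xs
    ≡⟨ cong (λ r → xs ++ true ∷ zeros ++ r) (++-assoc zeros [ true ] (reverse xs)) ⟩
  xs ++ true ∷ zeros ++ zeros ++ true ∷ reverse xs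
    ∎
  where zeros = replicate t false

centred-mirror-replicate : ∀ n → Centred (3 + (n + n)) (freeTypeRepᴸ (mirror (replicate n false)))
centred-mirror-replicate n = [] , [] , refl , (begin
  freeTypeRepᴸ (zeros ++ reverse zeros)   ≡⟨ freeTypeRepᴸ≡blocks (zeros ++ reverse zeros) ⟩
  blocks 2 ((zeros ++ reverse zeros) ∷ʳ false)
    ≡⟨ cong (λ r → blocks 2 ((zeros ++ r) ∷ʳ false)) (reverse-replicate n false) ⟩
  blocks 2 ((zeros ++ zeros) ∷ʳ false)    ≡⟨ cong (blocks 2) (++-assoc zeros zeros [ false ]) ⟩
  blocks 2 (zeros ++ zeros ∷ʳ false)      ≡⟨ blocks-replicate-false 2 n _ ⟩
  blocks (2 + n) (zeros ∷ʳ false)         ≡⟨ blocks-replicate-false (2 + n) n [ false ] ⟩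
  blocks (2 + n + n) [ false ]            ∎)
  where zeros = replicate n false

centred-mirror-++-true : ∀ xs t →
                         Centred (1 + (t + t)) (freeTypeRepᴸ (mirror (xs ++ true ∷ replicate t false)))
centred-mirror-++-true xs t = blocks 2 xs , blocks 1 (reverse xs ∷ʳ false) , balanced , (begin
  freeTypeRepᴸ (mirror (xs ++ true ∷ zeros))
    ≡⟨ cong freeTypeRepᴸ (mirror-++-true xs t) ⟩
  freeTypeRepᴸ (xs ++ true ∷ zeros ++ zeros ++ true ∷ reverse xs)
    ≡⟨ freeTypeRepᴸ≡blocks (xs ++ true ∷ zeros ++ zeros ++ true ∷ reverse xs) ⟩
  blocks 2 ((xs ++ true ∷ zeros ++ zeros ++ true ∷ reverse xs) ∷ʳ false)
    ≡⟨ cong (blocks 2) (++-assoc xs _ [ false ]) ⟩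
  blocks 2 (xs ++ true ∷ (zeros ++ zeros ++ true ∷ reverse xs) ∷ʳ false)
    ≡⟨ cong (λ r → blocks 2 (xs ++ true ∷ r)) (++-assoc zeros _ [ false ]) ⟩
  blocks 2 (xs ++ true ∷ zeros ++ (zeros ++ true ∷ reverse xs) ∷ʳ false)
    ≡⟨ cong (λ r → blocks 2 (xs ++ true ∷ zeros ++ r)) (++-assoc zeros _ [ false ]) ⟩
  blocks 2 (xs ++ true ∷ zeros ++ zeros ++ true ∷ (reverse xs ∷ʳ false))
    ≡⟨ blocks-++-true 2 xs _ ⟩
  blocks 2 xs ++ blocks 1 (zeros ++ zeros ++ true ∷ (reverse xs ∷ʳ false))
    ≡⟨ cong (blocks 2 xs ++_) (blocks-replicate-false 1 t _) ⟩
  blocks 2 xs ++ blocks (1 + t) (zeros ++ true ∷ (reverse xs ∷ʳ false))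
    ≡⟨ cong (blocks 2 xs ++_) (blocks-replicate-false (1 + t) t _) ⟩
  blocks 2 xs ++ (1 + (t + t)) ∷ blocks 1 (reverse xs ∷ʳ false)
    ∎)
  where
  zeros = replicate t false
  balanced : length (blocks 2 xs) ≡ length (blocks 1 (reverse xs ∷ʳ false))
  balanced = begin
    length (blocks 2 xs)                        ≡⟨ length-blocks 2 xs ⟩
    suc (countTrue xs)                          ≡⟨ cong suc (countTrue-reverse xs) ⟨
    suc (countTrue (reverse xs))                ≡⟨ cong suc (+-identityʳ _) ⟨
    suc (countTrue (reverse xs) + 0)            ≡⟨ cong suc (countTrue-++ (reverse xs) [ false ]) ⟨
    suc (countTrue (reverse xs ∷ʳ false))       ≡⟨ length-blocks 1 (reverse xs ∷ʳ false) ⟨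
    length (blocks 1 (reverse xs ∷ʳ false))     ∎

data TrailingFalses : List Bool → Set where
  all-false : ∀ n → TrailingFalses (replicate n false)
  last-true : ∀ xs t → TrailingFalses (xs ++ true ∷ replicate t false)

trailingFalses : ∀ bs → TrailingFalses bs
trailingFalses []       = all-false 0
trailingFalses (b ∷ bs) = cons b (trailingFalses bs)
  where
  cons : ∀ b {bs} → TrailingFalses bs → TrailingFalses (b ∷ bs)
  cons false (all-false n)   = all-false (suc n)
  cons true  (all-false n)   = last-true [] n
  cons b     (last-true xs t) = last-true (b ∷ xs) t

pivotCandidates : ℕ → List ℕ
pivotCandidates j = 3 + (j + j) ∷ applyUpTo (λ t → 1 + (t + t)) j

length-pivotCandidates : ∀ j → length (pivotCandidates j) ≡ suc j
length-pivotCandidates j = cong suc (length-applyUpTo _ j)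

pivotCandidates-unique : ∀ j → Unique (pivotCandidates j)
pivotCandidates-unique j =
  All.tabulate head-fresh ∷ applyUpTo⁺₁ _ j (λ s<t _ → <⇒≢ (s≤s (+-mono-< s<t s<t)))
  where
  head-fresh : ∀ {p} → p ∈ applyUpTo (λ t → 1 + (t + t)) j → 3 + (j + j) ≢ p
  head-fresh p∈ with t , t<j , refl ← ∈-applyUpTo⁻ _ p∈ =
    >⇒≢ (s≤s (m<n⇒m<1+n (m<n⇒m<1+n (+-mono-< t<j t<j))))

mirror-centred : ∀ {u} → TrailingFalses u →
                 ∃ λ p → p ∈ pivotCandidates (length u) × Centred p (freeTypeRepᴸ (mirror u))
mirror-centred (all-false n) =
  _ , here (cong (λ k → 3 + (k + k)) (sym (length-replicate n))) , centred-mirror-replicate n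
mirror-centred (last-true xs t) =
  _ , there (∈-applyUpTo⁺ _ t<length) , centred-mirror-++-true xs t
  where
  t<length : t < length (xs ++ true ∷ replicate t false)
  t<length = subst (t <_) (sym (length-++ xs))
    (≤-trans (s≤s (≤-reflexive (sym (length-replicate t)))) (m≤n+m _ (length xs)))

mirror-pivot∈pivotCandidates : ∀ u → middle (freeTypeRepᴸ (mirror u)) ∈ pivotCandidates (length u)
mirror-pivot∈pivotCandidates u with p , p∈ , centred ← mirror-centred (trailingFalses u) =
  subst (_∈ pivotCandidates (length u)) (sym (middle-centred centred)) p∈

mirror-oddFree : ∀ u → length (freeTypeRepᴸ (mirror u)) % 2 ≡ 1
mirror-oddFree u = length-centred-odd (proj₂ (proj₂ (mirror-centred (trailingFalses u))))

pivotCandidate-realised : ∀ j {p} → p ∈ pivotCandidates j →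
                          ∃ λ u → length u ≡ j × Centred p (freeTypeRepᴸ (mirror u))
pivotCandidate-realised j (here refl) = replicate j false , length-replicate j , centred-mirror-replicate j
pivotCandidate-realised j (there p∈) with t , t<j , refl ← ∈-applyUpTo⁻ _ p∈ =
  zeros (j ∸ suc t) ++ true ∷ zeros t , length-u , centred-mirror-++-true (zeros (j ∸ suc t)) t
  where
  zeros : ℕ → List Bool
  zeros n = replicate n false
  length-u : length (zeros (j ∸ suc t) ++ true ∷ zeros t) ≡ j
  length-u = begin
    length (zeros (j ∸ suc t) ++ true ∷ zeros t)  ≡⟨ length-++ (zeros (j ∸ suc t)) ⟩
    length (zeros (j ∸ suc t)) + suc (length (zeros t))
      ≡⟨ cong₂ (λ a b → a + suc b) (length-replicate (j ∸ suc t)) (length-replicate t) ⟩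
    j ∸ suc t + suc t                             ≡⟨ m∸n+n≡m t<j ⟩
    j                                             ∎

selfTwin⇒palindrome : ∀ {m} (v : Vec Bool m) → SelfTwin v → toList v ≡ reverse (toList v)
selfTwin⇒palindrome v selfTwin = trans (cong toList selfTwin) (toList-reverse v)

palindrome⇒selfTwin : ∀ {m} (v : Vec Bool m) → toList v ≡ reverse (toList v) → SelfTwin v
palindrome⇒selfTwin v palindrome =
  trans (sym (cast-is-id refl v))
        (toList-injective refl v (Vec.reverse v) (trans palindrome (sym (toList-reverse v))))

∈-allVecs : ∀ {m} (v : Vec Bool m) → v ∈ allVecs m
∈-allVecs Vec.[]      = here refl
∈-allVecs (b Vec.∷ v) = ∈-concatMap⁺ _ (Any.map (λ { refl → ∈-pair b }) (∈-allVecs v))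
  where
  ∈-pair : ∀ b → (b Vec.∷ v) ∈ (false Vec.∷ v) ∷ (true Vec.∷ v) ∷ []
  ∈-pair false = here refl
  ∈-pair true  = there (here refl)

qualifyingPivots : ℕ → List ℕ
qualifyingPivots m = map pivot (filter qualifies? (allVecs m))

qualifyingPivots⊆pivotCandidates : ∀ j {p} → p ∈ qualifyingPivots (j + j) → p ∈ pivotCandidates j
qualifyingPivots⊆pivotCandidates j p∈ with v , v∈ , refl ← ∈-map⁻ pivot p∈ =
  selfTwin-pivot v (proj₁ (proj₂ (∈-filter⁻ qualifies? {xs = allVecs (j + j)} v∈)))
  where
  selfTwin-pivot : (v : Vec Bool (j + j)) → SelfTwin v → pivot v ∈ pivotCandidates j
  selfTwin-pivot v selfTwin
    with u , refl , v≡mirror ← palindrome-mirror j (toList v) (length-toList v) (selfTwin⇒palindrome v selfTwin) =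
    subst (_∈ pivotCandidates (length u)) (cong (middle ∘ freeTypeRepᴸ) (sym v≡mirror))
          (mirror-pivot∈pivotCandidates u)

mirror-pivot∈qualifyingPivots : ∀ u →
                                middle (freeTypeRepᴸ (mirror u)) ∈ qualifyingPivots (length u + length u)
mirror-pivot∈qualifyingPivots u =
  subst (_∈ qualifyingPivots (length u + length u)) (cong (middle ∘ freeTypeRepᴸ) v≡mirror)
    (∈-map⁺ pivot (∈-filter⁺ qualifies? (∈-allVecs v) (selfTwin , oddFree)))
  where
  v : Vec Bool (length u + length u)
  v = Vec.cast (length-mirror u) (Vec.fromList (mirror u))
  v≡mirror : toList v ≡ mirror u
  v≡mirror = trans (toList-cast (length-mirror u) (Vec.fromList (mirror u))) (toList∘fromList (mirror u))
  selfTwin : SelfTwin v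
  selfTwin =
    palindrome⇒selfTwin v (trans v≡mirror (trans (mirror-palindrome u) (cong reverse (sym v≡mirror))))
  oddFree : OddFree v
  oddFree = subst (λ bs → length (freeTypeRepᴸ bs) % 2 ≡ 1) (sym v≡mirror) (mirror-oddFree u)

pivotCandidates⊆qualifyingPivots : ∀ j {p} → p ∈ pivotCandidates j → p ∈ qualifyingPivots (j + j)
pivotCandidates⊆qualifyingPivots j p∈ with u , refl , centred ← pivotCandidate-realised j p∈ =
  subst (_∈ qualifyingPivots _) (middle-centred centred) (mirror-pivot∈qualifyingPivots u)

length-pivotValues : ∀ j → length (pivotValues (j + j)) ≡ suc j
length-pivotValues j = trans
  (length-deduplicate-≡ _≟_ (pivotCandidates-unique j)
    (mk⇔ (qualifyingPivots⊆pivotCandidates j) (pivotCandidates⊆qualifyingPivots j)))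
  (length-pivotCandidates j)

proposition7p1 : (m : ℕ) → 2 ∣ m → length (pivotValues m) ≡ m / 2 + 1
proposition7p1 .(j * 2) (divides j refl) = begin
  length (pivotValues (j * 2))  ≡⟨ cong (length ∘ pivotValues) (n+n≡n*2 j) ⟨
  length (pivotValues (j + j))  ≡⟨ length-pivotValues j ⟩
  suc j                         ≡⟨ +-comm 1 j ⟩
  j + 1                         ≡⟨ cong (_+ 1) (m*n/n≡m j 2) ⟨
  j * 2 / 2 + 1                 ∎
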